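{- Let $k$ be an even positive integer. For every integer $n>0$, let $b=\lfloor \log_2 n\rfloor$ and $c=n+1-2^{b}$. Then $$d_k(n)=\frac{(2^b+c)^k+(2^b-c)^k-(2^b+c-1)^k-(2^b-c+1)^k-2c^k+2(c-1)^k}{2^{b+1}}+d_k(c-1).$$
   Context: A P-position of the game of Nim with $k$ piles is a $k$-tuple $(p_1,\dots,p_k)$ of non-negative integers whose nim-sum $p_1\oplus\cdots\oplus p_k$ is $0$, where $\oplus$ denotes bitwise XOR. $d_k(m)$ denotes the number of P-positions with $k$ piles whose largest pile has exactly $m$ counters, for $m\ge 0$ (so $d_k(0)=1$). -}

module Defs where

open import Data.Nat using (ℕ; zero; suc; _+_; _*_; _⊔_; _≟_)
open import Data.Nat.DivMod using (_/_; _%_)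
open import Data.List using (List; []; _∷_; map; concatMap; upTo; filter; length)
open import Data.Vec using (Vec; []; _∷_; foldr)
open import Data.Product using (_×_)
open import Relation.Binary.PropositionalEquality using (_≡_)
open import Relation.Nullary.Decidable using (_×-dec_)

-- Bitwise XOR on ℕ (binary digits, least significant first).
-- The fuel argument only needs to be at least the number of bits;
-- we always call it with fuel m + n, which suffices.
xorAux : ℕ → ℕ → ℕ → ℕ
xorAux zero    m n = 0
xorAux (suc f) m n = ((m % 2) + (n % 2)) % 2 + 2 * xorAux f (m / 2) (n / 2)

infixl 6 _⊕_
_⊕_ : ℕ → ℕ → ℕ
m ⊕ n = xorAux (m + n) m n

nimSum : ∀ {k} → Vec ℕ k → ℕ
nimSum = foldr _ _⊕_ 0

maxPile : ∀ {k} → Vec ℕ k → ℕ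
maxPile = foldr _ _⊔_ 0

tuples : (k m : ℕ) → List (Vec ℕ k)
tuples zero    m = [] ∷ []
tuples (suc k) m = concatMap (λ x → map (x ∷_) (tuples k m)) (upTo (suc m))

IsPPosMax : ∀ {k} → ℕ → Vec ℕ k → Set
IsPPosMax m v = (nimSum v ≡ 0) × (maxPile v ≡ m)

d : ℕ → ℕ → ℕ
d k m = length (filter (λ v → (nimSum v ≟ 0) ×-dec (maxPile v ≟ m)) (tuples k m))

-- Write B = 2^b and let N_k(M, t) count the k-tuples in [0, M)^k with nim-sum t.  A P-position with
-- largest pile n lies in [0, n]^k but not in [0, n)^k, so d_k(n) = N_k(n + 1, 0) − N_k(n, 0).
-- For c ≤ B split [0, B + c) into [0, B) and B + [0, c).  Tuples with all entries in the upper block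
-- have nim-sum (k mod 2)·B ⊕ (nim-sum of the offsets), so for even k and a target below B they
-- contribute N_k(c, t); the other tuples contribute an amount U_k(c) that does not depend on the
-- low bits of the target, since an entry ranging over [0, B) can be xored onto anything.  Hence
-- N_k(B + c, 0) = U_k(c) + N_k(c, 0) and, with n + 1 = B + c,
--   d_k(n) = U_k(c) − U_k(c − 1) + d_k(c − 1).
-- Splitting on the first entry gives a linear recursion for U_k, solved by
--   2B·U_k(c) = (B + c)^k + (B − c)^k − 2c^k   for even k.

module Submission where

open import Defs
open import Data.Bool using (Bool; true; false; not; _∧_; _xor_)
open import Data.Bool.Properties using (not-involutive; not-distribˡ-xor; not-distribʳ-xor)
open import Data.List using (List; []; _∷_; _++_; map; concatMap; applyUpTo; upTo; filter; length)
open import Data.List.Properties using (map-++; map-∘)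
open import Data.Nat
open import Data.Nat.DivMod
open import Data.Nat.Divisibility using (_∣_; divides; n∣m*n)
open import Data.Nat.Induction using (<-wellFounded)
open import Data.Nat.ListAction using (sum)
open import Data.Nat.ListAction.Properties using (sum-++)
open import Data.Nat.Logarithm using (⌊log₂_⌋; ⌊log₂⌋-mono-≤; ⌊log₂[2^n]⌋≡n)
open import Data.Nat.Logarithm.Core using (⌊log2⌋)
open import Data.Nat.Properties
open import Data.Nat.Tactic.RingSolver using (solve-∀)
open import Data.Sum using (inj₁; inj₂)
open import Data.Vec using (Vec; []; _∷_)
open import Data.Vec.Relation.Unary.All using (All; []; _∷_)
open import Function using (_∘_; _⇔_; mk⇔; Equivalence)
open import Induction.WellFounded using (acc)
open import Relation.Binary.PropositionalEquality
open import Relation.Nullary using (Dec; does)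
open import Relation.Nullary.Decidable using (does-⇔; dec-true; dec-false; _×-dec_)
open import Relation.Unary using (Decidable)

-- Nim-sum and binary digits

xorAux-zero : ∀ f → xorAux f 0 0 ≡ 0
xorAux-zero zero    = refl
xorAux-zero (suc f) = cong (2 *_) (xorAux-zero f)

m+n≤1+f⇒m/2+n/2≤f : ∀ m n f → m + n ≤ suc f → m / 2 + n / 2 ≤ f
m+n≤1+f⇒m/2+n/2≤f m n f m+n≤1+f = ≤-pred (*-cancelʳ-< _ (m / 2 + n / 2) (suc f) (begin-strict
  (m / 2 + n / 2) * 2      ≡⟨ *-distribʳ-+ 2 (m / 2) (n / 2) ⟩
  m / 2 * 2 + n / 2 * 2    ≤⟨ +-mono-≤ (m/n*n≤m m 2) (m/n*n≤m n 2) ⟩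
  m + n                    ≤⟨ m+n≤1+f ⟩
  suc f                    <⟨ m<m*n (suc f) 2 ≤-refl ⟩
  suc f * 2                ∎))
  where open ≤-Reasoning

xorAux-fuel : ∀ f g m n → m + n ≤ f → m + n ≤ g → xorAux f m n ≡ xorAux g m n
xorAux-fuel zero    zero    m    n    _ _ = refl
xorAux-fuel zero    (suc g) zero zero _ _ = sym (cong (2 *_) (xorAux-zero g))
xorAux-fuel (suc f) zero    zero zero _ _ = cong (2 *_) (xorAux-zero f)
xorAux-fuel (suc f) (suc g) m    n    p q = cong (λ z → (m % 2 + n % 2) % 2 + 2 * z)
  (xorAux-fuel f g (m / 2) (n / 2) (m+n≤1+f⇒m/2+n/2≤f m n f p) (m+n≤1+f⇒m/2+n/2≤f m n g q))

⊕-halves : ∀ m n → m ⊕ n ≡ (m % 2 + n % 2) % 2 + (m / 2 ⊕ n / 2) * 2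
⊕-halves m n = trans (unfolded m n) (cong ((m % 2 + n % 2) % 2 +_) (*-comm 2 (m / 2 ⊕ n / 2)))
  where
  unfolded : ∀ m n → m ⊕ n ≡ (m % 2 + n % 2) % 2 + 2 * (m / 2 ⊕ n / 2)
  unfolded zero    zero    = refl
  unfolded zero    (suc n) = cong (λ z → (0 % 2 + suc n % 2) % 2 + 2 * z)
    (xorAux-fuel n _ 0 (suc n / 2) (m+n≤1+f⇒m/2+n/2≤f 0 (suc n) n ≤-refl) ≤-refl)
  unfolded (suc m) n       = cong (λ z → (suc m % 2 + n % 2) % 2 + 2 * z)
    (xorAux-fuel (m + n) _ (suc m / 2) (n / 2) (m+n≤1+f⇒m/2+n/2≤f (suc m) n (m + n) ≤-refl) ≤-refl)

[a+q*2]%2≡a : ∀ {a} q → a < 2 → (a + q * 2) % 2 ≡ a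
[a+q*2]%2≡a {a} q a<2 = trans ([m+kn]%n≡m%n a q 2) (m<n⇒m%n≡m a<2)

[a+q*2]/2≡q : ∀ {a} q → a < 2 → (a + q * 2) / 2 ≡ q
[a+q*2]/2≡q {a} q a<2 = trans (+-distrib-/-∣ʳ a (n∣m*n q)) (cong₂ _+_ (m<n⇒m/n≡0 a<2) (m*n/n≡m q 2))

⊕-digits : ∀ {a a'} q q' → a < 2 → a' < 2 → (a + q * 2) ⊕ (a' + q' * 2) ≡ (a + a') % 2 + (q ⊕ q') * 2
⊕-digits {a} {a'} q q' a<2 a'<2 = begin
  (a + q * 2) ⊕ (a' + q' * 2)
    ≡⟨ ⊕-halves (a + q * 2) (a' + q' * 2) ⟩
  ((a + q * 2) % 2 + (a' + q' * 2) % 2) % 2 + ((a + q * 2) / 2 ⊕ (a' + q' * 2) / 2) * 2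
    ≡⟨ cong₂ (λ u v → (u + v) % 2 + ((a + q * 2) / 2 ⊕ (a' + q' * 2) / 2) * 2)
             ([a+q*2]%2≡a q a<2) ([a+q*2]%2≡a q' a'<2) ⟩
  (a + a') % 2 + ((a + q * 2) / 2 ⊕ (a' + q' * 2) / 2) * 2
    ≡⟨ cong₂ (λ u v → (a + a') % 2 + (u ⊕ v) * 2) ([a+q*2]/2≡q q a<2) ([a+q*2]/2≡q q' a'<2) ⟩
  (a + a') % 2 + (q ⊕ q') * 2
    ∎
  where open ≡-Reasoning

⊕-comm : ∀ m n → m ⊕ n ≡ n ⊕ m
⊕-comm m n = trans (xorAux-comm (m + n) m n) (cong (λ f → xorAux f n m) (+-comm m n))
  where
  xorAux-comm : ∀ f m n → xorAux f m n ≡ xorAux f n m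
  xorAux-comm zero    m n = refl
  xorAux-comm (suc f) m n = cong₂ (λ u v → u % 2 + 2 * v) (+-comm (m % 2) (n % 2)) (xorAux-comm f (m / 2) (n / 2))

⊕-cancelˡ : ∀ x t → x ⊕ (x ⊕ t) ≡ t
⊕-cancelˡ x t = cancel (x + t) x t ≤-refl
  where
  bit-cancel : ∀ {a e} → a < 2 → e < 2 → (a + (a + e) % 2) % 2 ≡ e
  bit-cancel {0} {0} _ _ = refl
  bit-cancel {0} {1} _ _ = refl
  bit-cancel {1} {0} _ _ = refl
  bit-cancel {1} {1} _ _ = refl
  bit-cancel {suc (suc _)} (s≤s (s≤s ())) _
  bit-cancel {_} {suc (suc _)} _ (s≤s (s≤s ()))

  cancel : ∀ f x t → x + t ≤ f → x ⊕ (x ⊕ t) ≡ t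
  cancel zero    zero zero _ = refl
  cancel (suc f) x    t    x+t≤1+f = begin
    x ⊕ (x ⊕ t)
      ≡⟨ cong₂ (λ u v → u ⊕ (u ⊕ v)) (m≡m%n+[m/n]*n x 2) (m≡m%n+[m/n]*n t 2) ⟩
    (x₀ + x₁ * 2) ⊕ ((x₀ + x₁ * 2) ⊕ (t₀ + t₁ * 2))
      ≡⟨ cong ((x₀ + x₁ * 2) ⊕_) (⊕-digits x₁ t₁ x₀<2 t₀<2) ⟩
    (x₀ + x₁ * 2) ⊕ ((x₀ + t₀) % 2 + (x₁ ⊕ t₁) * 2)
      ≡⟨ ⊕-digits x₁ (x₁ ⊕ t₁) x₀<2 (m%n<n (x₀ + t₀) 2) ⟩
    (x₀ + (x₀ + t₀) % 2) % 2 + (x₁ ⊕ (x₁ ⊕ t₁)) * 2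
      ≡⟨ cong₂ (λ u v → u + v * 2) (bit-cancel x₀<2 t₀<2) (cancel f x₁ t₁ (m+n≤1+f⇒m/2+n/2≤f x t f x+t≤1+f)) ⟩
    t₀ + t₁ * 2
      ≡⟨ m≡m%n+[m/n]*n t 2 ⟨
    t ∎
    where
    open ≡-Reasoning
    x₀ = x % 2
    x₁ = x / 2
    t₀ = t % 2
    t₁ = t / 2
    x₀<2 = m%n<n x 2
    t₀<2 = m%n<n t 2

⊕-solveˡ : ∀ x y z → x ⊕ y ≡ z ⇔ y ≡ x ⊕ z
⊕-solveˡ x y z = mk⇔ (λ { refl → sym (⊕-cancelˡ x y) }) (λ { refl → ⊕-cancelˡ x z })

bit : Bool → ℕ
bit true  = 1
bit false = 0

bit-∧ : ∀ a b → bit (a ∧ b) ≡ bit a * bit b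
bit-∧ true  true  = refl
bit-∧ true  false = refl
bit-∧ false _     = refl

m<2^[1+b]⇒m/2<2^b : ∀ b {m} → m < 2 ^ suc b → m / 2 < 2 ^ b
m<2^[1+b]⇒m/2<2^b b {m} m<2B = m<n*o⇒m/o<n (subst (m <_) (*-comm 2 (2 ^ b)) m<2B)

⊕-<2^ : ∀ b {x y} → x < 2 ^ b → y < 2 ^ b → x ⊕ y < 2 ^ b
⊕-<2^ zero    (s≤s z≤n) (s≤s z≤n) = s≤s z≤n
⊕-<2^ (suc b) {x} {y} x<2B y<2B = begin-strict
  x ⊕ y                                   ≡⟨ ⊕-halves x y ⟩
  (x % 2 + y % 2) % 2 + (x / 2 ⊕ y / 2) * 2  <⟨ +-monoˡ-< _ (m%n<n (x % 2 + y % 2) 2) ⟩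
  suc (x / 2 ⊕ y / 2) * 2                    ≤⟨ *-monoˡ-≤ 2 (⊕-<2^ b (m<2^[1+b]⇒m/2<2^b b x<2B) (m<2^[1+b]⇒m/2<2^b b y<2B)) ⟩
  2 ^ b * 2                                  ≡⟨ *-comm (2 ^ b) 2 ⟩
  2 ^ suc b                                  ∎
  where open ≤-Reasoning

⊕-topBit : ∀ b h h' {x y} → x < 2 ^ b → y < 2 ^ b →
  (bit h * 2 ^ b + x) ⊕ (bit h' * 2 ^ b + y) ≡ bit (h xor h') * 2 ^ b + (x ⊕ y)
⊕-topBit zero true  true  (s≤s z≤n) (s≤s z≤n) = refl
⊕-topBit zero true  false (s≤s z≤n) (s≤s z≤n) = refl
⊕-topBit zero false true  (s≤s z≤n) (s≤s z≤n) = refl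
⊕-topBit zero false false (s≤s z≤n) (s≤s z≤n) = refl
⊕-topBit (suc b) h h' {x} {y} x<2B y<2B = begin
  (bit h * (2 * B) + x) ⊕ (bit h' * (2 * B) + y)
    ≡⟨ cong₂ _⊕_ (topBit-digits h x) (topBit-digits h' y) ⟩
  (x % 2 + (bit h * B + x / 2) * 2) ⊕ (y % 2 + (bit h' * B + y / 2) * 2)
    ≡⟨ ⊕-digits (bit h * B + x / 2) (bit h' * B + y / 2) (m%n<n x 2) (m%n<n y 2) ⟩
  (x % 2 + y % 2) % 2 + ((bit h * B + x / 2) ⊕ (bit h' * B + y / 2)) * 2
    ≡⟨ cong (λ z → (x % 2 + y % 2) % 2 + z * 2) (⊕-topBit b h h' (m<2^[1+b]⇒m/2<2^b b x<2B) (m<2^[1+b]⇒m/2<2^b b y<2B)) ⟩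
  (x % 2 + y % 2) % 2 + (bit (h xor h') * B + (x / 2 ⊕ y / 2)) * 2
    ≡⟨ shift-digit ((x % 2 + y % 2) % 2) (bit (h xor h')) B (x / 2 ⊕ y / 2) ⟨
  bit (h xor h') * (2 * B) + ((x % 2 + y % 2) % 2 + (x / 2 ⊕ y / 2) * 2)
    ≡⟨ cong (bit (h xor h') * (2 * B) +_) (⊕-halves x y) ⟨
  bit (h xor h') * (2 * B) + (x ⊕ y)
    ∎
  where
  open ≡-Reasoning
  B = 2 ^ b
  shift-digit : ∀ r H B z → H * (2 * B) + (r + z * 2) ≡ r + (H * B + z) * 2
  shift-digit = solve-∀
  topBit-digits : ∀ h x → bit h * (2 * B) + x ≡ x % 2 + (bit h * B + x / 2) * 2
  topBit-digits h x = trans (cong (bit h * (2 * B) +_) (m≡m%n+[m/n]*n x 2)) (shift-digit (x % 2) (bit h) B (x / 2))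

-- By recursion on the accessibility proof on which ⌊log₂_⌋ itself recurses.
2^⌊log₂n⌋≤n : ∀ {n} → 0 < n → 2 ^ ⌊log₂ n ⌋ ≤ n
2^⌊log₂n⌋≤n {suc n} _ = 2^⌊log2⌋≤1+n n (<-wellFounded (suc n))
  where
  2^⌊log2⌋≤1+n : ∀ n acc → 2 ^ ⌊log2⌋ (suc n) acc ≤ suc n
  2^⌊log2⌋≤1+n zero    _        = ≤-refl
  2^⌊log2⌋≤1+n (suc n) (acc rs) = begin
    2 * 2 ^ ⌊log2⌋ (suc ⌊ n /2⌋) _  ≤⟨ *-monoʳ-≤ 2 (2^⌊log2⌋≤1+n ⌊ n /2⌋ _) ⟩
    2 * suc ⌊ n /2⌋                 ≡⟨ *-suc 2 ⌊ n /2⌋ ⟩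
    suc (suc (2 * ⌊ n /2⌋))         ≤⟨ s≤s (s≤s 2*⌊n/2⌋≤n) ⟩
    suc (suc n)                     ∎
    where
    open ≤-Reasoning
    2*⌊n/2⌋≤n : 2 * ⌊ n /2⌋ ≤ n
    2*⌊n/2⌋≤n = begin
      2 * ⌊ n /2⌋             ≡⟨ cong (⌊ n /2⌋ +_) (+-identityʳ ⌊ n /2⌋) ⟩
      ⌊ n /2⌋ + ⌊ n /2⌋       ≤⟨ +-monoʳ-≤ ⌊ n /2⌋ (⌊n/2⌋≤⌈n/2⌉ n) ⟩
      ⌊ n /2⌋ + ⌈ n /2⌉       ≡⟨ ⌊n/2⌋+⌈n/2⌉≡n n ⟩
      n                       ∎

n<2^[1+⌊log₂n⌋] : ∀ n → n < 2 ^ suc ⌊log₂ n ⌋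
n<2^[1+⌊log₂n⌋] n = ≰⇒> λ 2^[1+b]≤n →
  1+n≰n (subst (_≤ ⌊log₂ n ⌋) (⌊log₂[2^n]⌋≡n (suc ⌊log₂ n ⌋)) (⌊log₂⌋-mono-≤ 2^[1+b]≤n))

-- Sums over ranges and over tuples

∑< : ℕ → (ℕ → ℕ) → ℕ
∑< zero    f = 0
∑< (suc N) f = f 0 + ∑< N (f ∘ suc)

infixl 10 ∑<
syntax ∑< N (λ x → e) = ∑[ x < N ] e

∑-cong : ∀ N {f g} → (∀ {x} → x < N → f x ≡ g x) → ∑< N f ≡ ∑< N g
∑-cong zero    f≗g = refl
∑-cong (suc N) f≗g = cong₂ _+_ (f≗g z<s) (∑-cong N (f≗g ∘ s<s))

∑-const : ∀ N a → ∑[ _ < N ] a ≡ N * a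
∑-const zero    a = refl
∑-const (suc N) a = cong (a +_) (∑-const N a)

∑-distrib-+ : ∀ N f g → ∑[ x < N ] (f x + g x) ≡ ∑< N f + ∑< N g
∑-distrib-+ zero    f g = refl
∑-distrib-+ (suc N) f g = trans (cong (f 0 + g 0 +_) (∑-distrib-+ N (f ∘ suc) (g ∘ suc)))
                                (+-assoc-comm (f 0) (g 0) (∑< N (f ∘ suc)) (∑< N (g ∘ suc)))
  where
  +-assoc-comm : ∀ a b c d → a + b + (c + d) ≡ a + c + (b + d)
  +-assoc-comm = solve-∀

∑-distribˡ : ∀ N a f → ∑[ x < N ] (a * f x) ≡ a * ∑< N f
∑-distribˡ zero    a f = sym (*-zeroʳ a)
∑-distribˡ (suc N) a f = trans (cong (a * f 0 +_) (∑-distribˡ N a (f ∘ suc))) (sym (*-distribˡ-+ a (f 0) _))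

∑-affine : ∀ N a e f → ∑[ x < N ] (a + e * f x) ≡ N * a + e * ∑< N f
∑-affine N a e f = trans (∑-distrib-+ N (λ _ → a) (λ x → e * f x)) (cong₂ _+_ (∑-const N a) (∑-distribˡ N e f))

∑-++ : ∀ A C f → ∑< (A + C) f ≡ ∑< A f + ∑[ y < C ] f (A + y)
∑-++ zero    C f = refl
∑-++ (suc A) C f = trans (cong (f 0 +_) (∑-++ A C (f ∘ suc))) (sym (+-assoc (f 0) _ _))

∑-init-last : ∀ N f → ∑< (suc N) f ≡ ∑< N f + f N
∑-init-last zero    f = +-identityʳ (f 0)
∑-init-last (suc N) f = trans (cong (f 0 +_) (∑-init-last N (f ∘ suc))) (sym (+-assoc (f 0) _ _))

∑-comm : ∀ N M (F : ℕ → ℕ → ℕ) → ∑[ x < N ] (∑[ y < M ] F x y) ≡ ∑[ y < M ] (∑[ x < N ] F x y)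
∑-comm zero    M F = sym (trans (∑-const M 0) (*-zeroʳ M))
∑-comm (suc N) M F = trans (cong (∑< M (F 0) +_) (∑-comm N M (F ∘ suc)))
                           (sym (∑-distrib-+ M (F 0) (λ y → ∑[ x < N ] F (suc x) y)))

𝟙 : ∀ {p} {A : Set p} → Dec A → ℕ
𝟙 A? = bit (does A?)

∑-indicator : ∀ N {a} → a < N → ∑[ x < N ] 𝟙 (x ≟ a) ≡ 1
∑-indicator (suc N) {zero}  _         = cong suc (trans (∑-const N 0) (*-zeroʳ N))
∑-indicator (suc N) {suc a} (s≤s a<N) =
  trans (∑-cong N λ {x} _ → cong bit (does-⇔ (mk⇔ suc-injective (cong suc)) (suc x ≟ suc a) (x ≟ a)))
        (∑-indicator N a<N)

∑Vec : (k M : ℕ) → (Vec ℕ k → ℕ) → ℕ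
∑Vec zero    M f = f []
∑Vec (suc k) M f = ∑[ x < M ] ∑Vec k M (λ v → f (x ∷ v))

∑Vec-cong : ∀ k M {f g} → (∀ {v} → All (_< M) v → f v ≡ g v) → ∑Vec k M f ≡ ∑Vec k M g
∑Vec-cong zero    M f≗g = f≗g []
∑Vec-cong (suc k) M f≗g = ∑-cong M λ x<M → ∑Vec-cong k M λ v<M → f≗g (x<M ∷ v<M)

∑Vec-distrib-+ : ∀ k M f g → ∑Vec k M (λ v → f v + g v) ≡ ∑Vec k M f + ∑Vec k M g
∑Vec-distrib-+ zero    M f g = refl
∑Vec-distrib-+ (suc k) M f g =
  trans (∑-cong M λ {x} _ → ∑Vec-distrib-+ k M (f ∘ (x ∷_)) (g ∘ (x ∷_))) (∑-distrib-+ M _ _)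

∑Vec-distribˡ : ∀ k M a f → ∑Vec k M (λ v → a * f v) ≡ a * ∑Vec k M f
∑Vec-distribˡ zero    M a f = refl
∑Vec-distribˡ (suc k) M a f = trans (∑-cong M λ {x} _ → ∑Vec-distribˡ k M a (f ∘ (x ∷_))) (∑-distribˡ M a _)

∑-∑Vec-comm : ∀ N k M (F : ℕ → Vec ℕ k → ℕ) → ∑[ x < N ] ∑Vec k M (F x) ≡ ∑Vec k M (λ v → ∑[ x < N ] F x v)
∑-∑Vec-comm N zero    M F = refl
∑-∑Vec-comm N (suc k) M F = trans (∑-comm N M λ x y → ∑Vec k M (F x ∘ (y ∷_)))
                                  (∑-cong M λ {y} _ → ∑-∑Vec-comm N k M λ x → F x ∘ (y ∷_))

∑Vec-1 : ∀ k M → ∑Vec k M (λ _ → 1) ≡ M ^ k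
∑Vec-1 zero    M = refl
∑Vec-1 (suc k) M = trans (∑-cong M λ _ → ∑Vec-1 k M) (∑-const M (M ^ k))

sum-map-applyUpTo : ∀ (f g : ℕ → ℕ) N → sum (map f (applyUpTo g N)) ≡ ∑[ x < N ] f (g x)
sum-map-applyUpTo f g zero    = refl
sum-map-applyUpTo f g (suc N) = cong (f (g 0) +_) (sum-map-applyUpTo f (g ∘ suc) N)

sum-map-concatMap : ∀ {A B : Set} (f : B → ℕ) (g : A → List B) xs →
  sum (map f (concatMap g xs)) ≡ sum (map (λ x → sum (map f (g x))) xs)
sum-map-concatMap f g []       = refl
sum-map-concatMap f g (x ∷ xs) = begin
  sum (map f (g x ++ concatMap g xs))                  ≡⟨ cong sum (map-++ f (g x) (concatMap g xs)) ⟩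
  sum (map f (g x) ++ map f (concatMap g xs))          ≡⟨ sum-++ (map f (g x)) _ ⟩
  sum (map f (g x)) + sum (map f (concatMap g xs))     ≡⟨ cong (sum (map f (g x)) +_) (sum-map-concatMap f g xs) ⟩
  sum (map f (g x)) + sum (map (λ x → sum (map f (g x))) xs) ∎
  where open ≡-Reasoning

sum-map-tuples : ∀ k m f → sum (map f (tuples k m)) ≡ ∑Vec k (suc m) f
sum-map-tuples zero    m f = +-identityʳ (f [])
sum-map-tuples (suc k) m f = begin
  sum (map f (concatMap (λ x → map (x ∷_) (tuples k m)) (upTo (suc m))))
    ≡⟨ sum-map-concatMap f (λ x → map (x ∷_) (tuples k m)) (upTo (suc m)) ⟩
  sum (map (λ x → sum (map f (map (x ∷_) (tuples k m)))) (upTo (suc m)))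
    ≡⟨ sum-map-applyUpTo (λ x → sum (map f (map (x ∷_) (tuples k m)))) (λ x → x) (suc m) ⟩
  ∑[ x < suc m ] sum (map f (map (x ∷_) (tuples k m)))
    ≡⟨ ∑-cong (suc m) (λ {x} _ → trans (cong sum (sym (map-∘ {g = f} {f = x ∷_} (tuples k m)))) (sum-map-tuples k m (f ∘ (x ∷_)))) ⟩
  ∑Vec (suc k) (suc m) f ∎
  where open ≡-Reasoning

length-filter : ∀ {A : Set} {P : A → Set} (P? : Decidable P) xs → length (filter P? xs) ≡ sum (map (𝟙 ∘ P?) xs)
length-filter P? []       = refl
length-filter P? (x ∷ xs) with does (P? x)
... | true  = cong suc (length-filter P? xs)
... | false = length-filter P? xs

-- Counting tuples by nim-sum

nimCount : (k M t : ℕ) → ℕ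
nimCount k M t = ∑Vec k M (λ v → 𝟙 (nimSum v ≟ t))

nimCount-suc : ∀ k M t → nimCount (suc k) M t ≡ ∑[ x < M ] nimCount k M (x ⊕ t)
nimCount-suc k M t = ∑-cong M λ {x} _ → ∑Vec-cong k M λ {v} _ →
  cong bit (does-⇔ (⊕-solveˡ x (nimSum v) t) (x ⊕ nimSum v ≟ t) (nimSum v ≟ x ⊕ t))

nimSum-<2^ : ∀ b {c k} {v : Vec ℕ k} → c ≤ 2 ^ b → All (_< c) v → nimSum v < 2 ^ b
nimSum-<2^ b c≤B []           = m^n>0 2 b
nimSum-<2^ b c≤B (x<c ∷ v<c) = ⊕-<2^ b (≤-trans x<c c≤B) (nimSum-<2^ b c≤B v<c)

∑-nimCount-⊕ : ∀ b {c} k {l} → c ≤ 2 ^ b → l < 2 ^ b → ∑[ x < 2 ^ b ] nimCount k c (x ⊕ l) ≡ c ^ k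
∑-nimCount-⊕ b {c} k {l} c≤B l<B = begin
  ∑[ x < 2 ^ b ] ∑Vec k c (λ v → 𝟙 (nimSum v ≟ x ⊕ l))
    ≡⟨ ∑-∑Vec-comm (2 ^ b) k c (λ x v → 𝟙 (nimSum v ≟ x ⊕ l)) ⟩
  ∑Vec k c (λ v → ∑[ x < 2 ^ b ] 𝟙 (nimSum v ≟ x ⊕ l))
    ≡⟨ ∑Vec-cong k c (λ {v} v<c → trans (∑-cong (2 ^ b) λ {x} _ →
                                            cong bit (does-⇔ (solve-for-x (nimSum v) x) (nimSum v ≟ x ⊕ l) (x ≟ l ⊕ nimSum v)))
                                    (∑-indicator (2 ^ b) (⊕-<2^ b l<B (nimSum-<2^ b c≤B v<c)))) ⟩
  ∑Vec k c (λ _ → 1)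
    ≡⟨ ∑Vec-1 k c ⟩
  c ^ k ∎
  where
  open ≡-Reasoning
  solve-for-x : ∀ s x → s ≡ x ⊕ l ⇔ x ≡ l ⊕ s
  solve-for-x s x = mk⇔ (λ s≡x⊕l → Equivalence.to (⊕-solveˡ l x s) (sym (trans s≡x⊕l (⊕-comm x l))))
                        (λ x≡l⊕s → trans (sym (Equivalence.from (⊕-solveˡ l x s) x≡l⊕s)) (⊕-comm l x))

odd : ℕ → Bool
odd zero    = false
odd (suc k) = not (odd k)

not-xor-odd-suc : ∀ h k → not (not h xor odd k) ≡ not (h xor odd (suc k))
not-xor-odd-suc h k = cong not (trans (sym (not-distribˡ-xor h (odd k))) (not-distribʳ-xor h (odd k)))

2∣⇒odd≡false : ∀ {k} → 2 ∣ k → odd k ≡ false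
2∣⇒odd≡false (divides q refl) = odd-*2 q
  where
  odd-*2 : ∀ q → odd (q * 2) ≡ false
  odd-*2 zero    = refl
  odd-*2 (suc q) = trans (not-involutive (odd (q * 2))) (odd-*2 q)

-- The number of tuples in [0, B + c)^k with some entry below B and nim-sum h·B + l, for any l < B.
mixedCount : (B c k : ℕ) → Bool → ℕ
mixedCount B c zero    h = 0
mixedCount B c (suc k) h =
  B * mixedCount B c k h + c * mixedCount B c k (not h) + bit (not (h xor odd k)) * c ^ k

nimCount-block : ∀ b {c} → c ≤ 2 ^ b → ∀ k h {l} → l < 2 ^ b →
  nimCount k (2 ^ b + c) (bit h * 2 ^ b + l)
    ≡ mixedCount (2 ^ b) c k h + bit (not (h xor odd k)) * nimCount k c l
nimCount-block b c≤B zero false {l} _ = sym (+-identityʳ _)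
nimCount-block b c≤B zero true  {l} _ = cong bit (dec-false (0 ≟ 1 * 2 ^ b + l) (λ 0≡B+l → <-irrefl 0≡B+l 0<B+l))
  where
  0<B+l : 0 < 1 * 2 ^ b + l
  0<B+l = ≤-trans (m^n>0 2 b) (≤-trans (m≤m+n (2 ^ b) 0) (m≤m+n _ l))
nimCount-block b {c} c≤B (suc k) h {l} l<B = begin
  nimCount (suc k) (B + c) t
    ≡⟨ nimCount-suc k (B + c) t ⟩
  ∑[ x < B + c ] nimCount k (B + c) (x ⊕ t)
    ≡⟨ ∑-++ B c (λ x → nimCount k (B + c) (x ⊕ t)) ⟩
  ∑[ x < B ] nimCount k (B + c) (x ⊕ t) + ∑[ y < c ] nimCount k (B + c) ((B + y) ⊕ t)
    ≡⟨ cong₂ _+_ low-block high-block ⟩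
  (B * mixedCount B c k h + same * c ^ k) + (c * mixedCount B c k (not h) + same' * nimCount (suc k) c l)
    ≡⟨ regroup (B * mixedCount B c k h) (same * c ^ k) (c * mixedCount B c k (not h)) _ ⟩
  mixedCount B c (suc k) h + same' * nimCount (suc k) c l
    ≡⟨ cong (λ e → mixedCount B c (suc k) h + bit e * nimCount (suc k) c l) (not-xor-odd-suc h k) ⟩
  mixedCount B c (suc k) h + bit (not (h xor odd (suc k))) * nimCount (suc k) c l ∎
  where
  open ≡-Reasoning
  B = 2 ^ b
  t = bit h * B + l
  same = bit (not (h xor odd k))
  same' = bit (not (not h xor odd k))

  regroup : ∀ a b c d → (a + b) + (c + d) ≡ (a + c + b) + d
  regroup = solve-∀

  shifted : ∀ h' {y} → y < B →
    nimCount k (B + c) ((bit h' * B + y) ⊕ t)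
      ≡ mixedCount B c k (h' xor h) + bit (not ((h' xor h) xor odd k)) * nimCount k c (y ⊕ l)
  shifted h' y<B = trans (cong (nimCount k (B + c)) (⊕-topBit b h' h y<B l<B))
                         (nimCount-block b c≤B k (h' xor h) (⊕-<2^ b y<B l<B))

  low-block : ∑[ x < B ] nimCount k (B + c) (x ⊕ t) ≡ B * mixedCount B c k h + same * c ^ k
  low-block = begin
    ∑[ x < B ] nimCount k (B + c) (x ⊕ t)
      ≡⟨ ∑-cong B (shifted false) ⟩
    ∑[ x < B ] (mixedCount B c k h + same * nimCount k c (x ⊕ l))
      ≡⟨ ∑-affine B _ same (λ x → nimCount k c (x ⊕ l)) ⟩
    B * mixedCount B c k h + same * ∑[ x < B ] nimCount k c (x ⊕ l)
      ≡⟨ cong (λ n → B * mixedCount B c k h + same * n) (∑-nimCount-⊕ b k c≤B l<B) ⟩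
    B * mixedCount B c k h + same * c ^ k ∎

  high-block : ∑[ y < c ] nimCount k (B + c) ((B + y) ⊕ t)
                 ≡ c * mixedCount B c k (not h) + same' * nimCount (suc k) c l
  high-block = begin
    ∑[ y < c ] nimCount k (B + c) ((B + y) ⊕ t)
      ≡⟨ ∑-cong c (λ {y} y<c → trans (cong (λ z → nimCount k (B + c) ((z + y) ⊕ t)) (sym (*-identityˡ B)))
                                     (shifted true (≤-trans y<c c≤B))) ⟩
    ∑[ y < c ] (mixedCount B c k (not h) + same' * nimCount k c (y ⊕ l))
      ≡⟨ ∑-affine c _ same' (λ y → nimCount k c (y ⊕ l)) ⟩
    c * mixedCount B c k (not h) + same' * ∑[ y < c ] nimCount k c (y ⊕ l)
      ≡⟨ cong (λ n → c * mixedCount B c k (not h) + same' * n) (nimCount-suc k c l) ⟨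
    c * mixedCount B c k (not h) + same' * nimCount (suc k) c l ∎

d≡∑Vec : ∀ k m → d k m ≡ ∑Vec k (suc m) (λ v → 𝟙 (nimSum v ≟ 0) * 𝟙 (maxPile v ≟ m))
d≡∑Vec k m = begin
  length (filter P? (tuples k m))  ≡⟨ length-filter P? (tuples k m) ⟩
  sum (map (𝟙 ∘ P?) (tuples k m))  ≡⟨ sum-map-tuples k m (𝟙 ∘ P?) ⟩
  ∑Vec k (suc m) (𝟙 ∘ P?)          ≡⟨ ∑Vec-cong k (suc m) (λ {v} _ → bit-∧ (does (nimSum v ≟ 0)) (does (maxPile v ≟ m))) ⟩
  ∑Vec k (suc m) (λ v → 𝟙 (nimSum v ≟ 0) * 𝟙 (maxPile v ≟ m)) ∎
  where
  open ≡-Reasoning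
  P? = λ (v : Vec ℕ k) → (nimSum v ≟ 0) ×-dec (maxPile v ≟ m)

maxPile-≤ : ∀ {m k} {v : Vec ℕ k} → All (_< suc m) v → maxPile v ≤ m
maxPile-≤ []           = z≤n
maxPile-≤ (x<m ∷ v<m) = ⊔-lub (≤-pred x<m) (maxPile-≤ v<m)

∑Vec-⊔maxPile< : ∀ k m a f → ∑Vec k (suc m) (λ v → 𝟙 (a ⊔ maxPile v <? m) * f v) ≡ 𝟙 (a <? m) * ∑Vec k m f
∑Vec-⊔maxPile< zero    m a f = cong (λ a → 𝟙 (a <? m) * f []) (⊔-identityʳ a)
∑Vec-⊔maxPile< (suc k) m a f = begin
  ∑[ x < suc m ] ∑Vec k (suc m) (λ v → 𝟙 (a ⊔ (x ⊔ maxPile v) <? m) * f (x ∷ v))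
    ≡⟨ ∑-cong (suc m) (λ {x} _ → trans (∑Vec-cong k (suc m) λ {v} _ →
                                         cong (λ u → 𝟙 (u <? m) * f (x ∷ v)) (sym (⊔-assoc a x (maxPile v))))
                                       (∑Vec-⊔maxPile< k m (a ⊔ x) (f ∘ (x ∷_)))) ⟩
  ∑[ x < suc m ] (𝟙 (a ⊔ x <? m) * g x)
    ≡⟨ ∑-init-last m (λ x → 𝟙 (a ⊔ x <? m) * g x) ⟩
  ∑[ x < m ] (𝟙 (a ⊔ x <? m) * g x) + 𝟙 (a ⊔ m <? m) * g m
    ≡⟨ cong₂ _+_ (∑-cong m λ {x} x<m → cong (λ e → bit e * g x) (does-⇔ (⊔<⇔< x<m) (a ⊔ x <? m) (a <? m)))
                 (cong (λ e → bit e * g m) (dec-false (a ⊔ m <? m) (≤⇒≯ (m≤n⊔m a m)))) ⟩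
  ∑[ x < m ] (𝟙 (a <? m) * g x) + 0
    ≡⟨ +-identityʳ _ ⟩
  ∑[ x < m ] (𝟙 (a <? m) * g x)
    ≡⟨ ∑-distribˡ m (𝟙 (a <? m)) g ⟩
  𝟙 (a <? m) * ∑Vec (suc k) m f ∎
  where
  open ≡-Reasoning
  g = λ x → ∑Vec k m (f ∘ (x ∷_))
  ⊔<⇔< : ∀ {x} → x < m → a ⊔ x < m ⇔ a < m
  ⊔<⇔< x<m = mk⇔ (≤-trans (s≤s (m≤m⊔n a _))) (λ a<m → ⊔-pres-<m a<m x<m)

-- Needs a pile: for 0 piles the empty tuple has largest pile 0 and the identity fails at m = 0.
d+nimCount≡nimCount : ∀ k m → d (suc k) m + nimCount (suc k) m 0 ≡ nimCount (suc k) (suc m) 0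
d+nimCount≡nimCount k m = sym (begin
  ∑Vec (suc k) (suc m) P
    ≡⟨ ∑Vec-cong (suc k) (suc m) {f = P} {g = λ v → P v * 𝟙 (maxPile v ≟ m) + 𝟙 (0 ⊔ maxPile v <? m) * P v}
                 (λ {v} v<m → split (P v) (max-or-below (maxPile-≤ v<m))) ⟩
  ∑Vec (suc k) (suc m) (λ v → P v * 𝟙 (maxPile v ≟ m) + 𝟙 (0 ⊔ maxPile v <? m) * P v)
    ≡⟨ ∑Vec-distrib-+ (suc k) (suc m) (λ v → P v * 𝟙 (maxPile v ≟ m)) (λ v → 𝟙 (0 ⊔ maxPile v <? m) * P v) ⟩
  ∑Vec (suc k) (suc m) (λ v → P v * 𝟙 (maxPile v ≟ m)) + ∑Vec (suc k) (suc m) (λ v → 𝟙 (0 ⊔ maxPile v <? m) * P v)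
    ≡⟨ cong₂ _+_ (d≡∑Vec (suc k) m) (sym (∑Vec-⊔maxPile< (suc k) m 0 P)) ⟨
  d (suc k) m + 𝟙 (0 <? m) * nimCount (suc k) m 0
    ≡⟨ cong (d (suc k) m +_) (nonempty m) ⟩
  d (suc k) m + nimCount (suc k) m 0 ∎)
  where
  open ≡-Reasoning
  P : Vec ℕ (suc k) → ℕ
  P v = 𝟙 (nimSum v ≟ 0)
  split : ∀ e {x y} → x + y ≡ 1 → e ≡ e * x + y * e
  split e {x} {y} x+y≡1 = begin
    e                ≡⟨ *-identityʳ e ⟨
    e * 1            ≡⟨ cong (e *_) x+y≡1 ⟨
    e * (x + y)      ≡⟨ *-distribˡ-+ e x y ⟩
    e * x + e * y    ≡⟨ cong (e * x +_) (*-comm e y) ⟩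
    e * x + y * e    ∎
  max-or-below : ∀ {u} → u ≤ m → 𝟙 (u ≟ m) + 𝟙 (u <? m) ≡ 1
  max-or-below {u} u≤m with m≤n⇒m<n∨m≡n u≤m
  ... | inj₁ u<m = cong₂ _+_ (cong bit (dec-false (u ≟ m) (<⇒≢ u<m))) (cong bit (dec-true (u <? m) u<m))
  ... | inj₂ u≡m = cong₂ _+_ (cong bit (dec-true (u ≟ m) u≡m)) (cong bit (dec-false (u <? m) (≤⇒≯ (≤-reflexive (sym u≡m)))))
  nonempty : ∀ m → 𝟙 (0 <? m) * nimCount (suc k) m 0 ≡ nimCount (suc k) m 0
  nonempty zero    = refl
  nonempty (suc m) = +-identityʳ _

nimCount-block-even : ∀ b {c} → c ≤ 2 ^ b → ∀ k → odd k ≡ false →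
  nimCount k (2 ^ b + c) 0 ≡ mixedCount (2 ^ b) c k false + nimCount k c 0
nimCount-block-even b {c} c≤B k odd-k = begin
  nimCount k (2 ^ b + c) 0
    ≡⟨ nimCount-block b c≤B k false (m^n>0 2 b) ⟩
  mixedCount (2 ^ b) c k false + bit (not (odd k)) * nimCount k c 0
    ≡⟨ cong (λ o → mixedCount (2 ^ b) c k false + bit (not o) * nimCount k c 0) odd-k ⟩
  mixedCount (2 ^ b) c k false + 1 * nimCount k c 0
    ≡⟨ cong (mixedCount (2 ^ b) c k false +_) (*-identityˡ (nimCount k c 0)) ⟩
  mixedCount (2 ^ b) c k false + nimCount k c 0 ∎
  where open ≡-Reasoning

d-recurrence : ∀ k b c → odd (suc k) ≡ false → c < 2 ^ b →
  d (suc k) (2 ^ b + c) + mixedCount (2 ^ b) c (suc k) false ≡ mixedCount (2 ^ b) (suc c) (suc k) false + d (suc k) c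
d-recurrence k b c odd-k c<B = +-cancelʳ-≡ (T c) (d K (B + c) + U) (U⁺ + d K c) (begin
  d K (B + c) + U + T c      ≡⟨ +-assoc (d K (B + c)) U (T c) ⟩
  d K (B + c) + (U + T c)    ≡⟨ cong (d K (B + c) +_) (nimCount-block-even b (<⇒≤ c<B) K odd-k) ⟨
  d K (B + c) + T (B + c)    ≡⟨ d+nimCount≡nimCount k (B + c) ⟩
  T (suc (B + c))            ≡⟨ cong T (+-suc B c) ⟨
  T (B + suc c)              ≡⟨ nimCount-block-even b c<B K odd-k ⟩
  U⁺ + T (suc c)             ≡⟨ cong (U⁺ +_) (d+nimCount≡nimCount k c) ⟨
  U⁺ + (d K c + T c)         ≡⟨ +-assoc U⁺ (d K c) (T c) ⟨
  U⁺ + d K c + T c           ∎)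
  where
  open ≡-Reasoning
  K = suc k
  B = 2 ^ b
  U = mixedCount B c K false
  U⁺ = mixedCount B (suc c) K false
  T : ℕ → ℕ
  T M = nimCount K M 0

-- Integer closed forms

open import Data.Integer as ℤ using (ℤ; +_)
import Data.Integer.Properties as ℤ
import Data.Integer.Tactic.RingSolver as ℤ-Solver

sign : Bool → ℤ
sign false = ℤ.1ℤ
sign true  = ℤ.-1ℤ

sign-not : ∀ h → sign (not h) ≡ ℤ.- sign h
sign-not false = refl
sign-not true  = refl

pos-^ : ∀ c k → + (c ^ k) ≡ (+ c) ℤ.^ k
pos-^ c zero    = refl
pos-^ c (suc k) = trans (ℤ.pos-* c (c ^ k)) (cong (+ c ℤ.*_) (pos-^ c k))

pos-mixedCount-suc : ∀ B c k h →
  + mixedCount B c (suc k) h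
    ≡ + B ℤ.* + mixedCount B c k h ℤ.+ + c ℤ.* + mixedCount B c k (not h) ℤ.+ + bit (not (h xor odd k)) ℤ.* (+ c) ℤ.^ k
pos-mixedCount-suc B c k h = begin
  + (B * U + c * U' + s * c ^ k)                     ≡⟨ ℤ.pos-+ (B * U + c * U') (s * c ^ k) ⟩
  + (B * U + c * U') ℤ.+ + (s * c ^ k)                ≡⟨ cong₂ ℤ._+_ (ℤ.pos-+ (B * U) (c * U')) (ℤ.pos-* s (c ^ k)) ⟩
  + (B * U) ℤ.+ + (c * U') ℤ.+ + s ℤ.* + (c ^ k)      ≡⟨ cong₂ (λ u v → u ℤ.+ v ℤ.+ + s ℤ.* + (c ^ k)) (ℤ.pos-* B U) (ℤ.pos-* c U') ⟩
  + B ℤ.* + U ℤ.+ + c ℤ.* + U' ℤ.+ + s ℤ.* + (c ^ k)  ≡⟨ cong (λ x → + B ℤ.* + U ℤ.+ + c ℤ.* + U' ℤ.+ + s ℤ.* x) (pos-^ c k) ⟩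
  + B ℤ.* + U ℤ.+ + c ℤ.* + U' ℤ.+ + s ℤ.* (+ c) ℤ.^ k ∎
  where
  open ≡-Reasoning
  U = mixedCount B c k h
  U' = mixedCount B c k (not h)
  s = bit (not (h xor odd k))

mixedCount-closedForm : ∀ B c k h →
  + 2 ℤ.* + B ℤ.* + mixedCount B c k h
    ≡ (+ B ℤ.+ + c) ℤ.^ k ℤ.+ sign h ℤ.* (+ B ℤ.- + c) ℤ.^ k ℤ.- + bit (not (h xor odd k)) ℤ.* (+ 2 ℤ.* (+ c) ℤ.^ k)
mixedCount-closedForm B c zero    false = ℤ.*-zeroʳ (+ 2 ℤ.* + B)
mixedCount-closedForm B c zero    true  = ℤ.*-zeroʳ (+ 2 ℤ.* + B)
mixedCount-closedForm B c (suc k) h = begin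
  + 2 ℤ.* + B ℤ.* + mixedCount B c (suc k) h
    ≡⟨ cong (+ 2 ℤ.* + B ℤ.*_) (pos-mixedCount-suc B c k h) ⟩
  + 2 ℤ.* + B ℤ.* (+ B ℤ.* + U ℤ.+ + c ℤ.* + U' ℤ.+ + s ℤ.* C)
    ≡⟨ expand (+ B) (+ c) (+ U) (+ U') (+ s) C ⟩
  + B ℤ.* (+ 2 ℤ.* + B ℤ.* + U) ℤ.+ + c ℤ.* (+ 2 ℤ.* + B ℤ.* + U') ℤ.+ + 2 ℤ.* + B ℤ.* + s ℤ.* C
    ≡⟨ cong₂ (λ u u' → + B ℤ.* u ℤ.+ + c ℤ.* u' ℤ.+ + 2 ℤ.* + B ℤ.* + s ℤ.* C)
             (mixedCount-closedForm B c k h) flipped-closedForm ⟩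
  + B ℤ.* (P ℤ.+ sign h ℤ.* Q ℤ.- + s ℤ.* (+ 2 ℤ.* C))
    ℤ.+ + c ℤ.* (P ℤ.+ ℤ.- sign h ℤ.* Q ℤ.- + s' ℤ.* (+ 2 ℤ.* C))
    ℤ.+ + 2 ℤ.* + B ℤ.* + s ℤ.* C
    ≡⟨ collect (+ B) (+ c) P Q C (sign h) (+ s) (+ s') ⟩
  (+ B ℤ.+ + c) ℤ.* P ℤ.+ sign h ℤ.* ((+ B ℤ.- + c) ℤ.* Q) ℤ.- + s' ℤ.* (+ 2 ℤ.* (+ c ℤ.* C))
    ≡⟨ cong (λ e → (+ B ℤ.+ + c) ℤ.* P ℤ.+ sign h ℤ.* ((+ B ℤ.- + c) ℤ.* Q) ℤ.- + bit e ℤ.* (+ 2 ℤ.* (+ c ℤ.* C)))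
            (not-xor-odd-suc h k) ⟩
  (+ B ℤ.+ + c) ℤ.^ suc k ℤ.+ sign h ℤ.* (+ B ℤ.- + c) ℤ.^ suc k ℤ.- + bit (not (h xor odd (suc k))) ℤ.* (+ 2 ℤ.* (+ c) ℤ.^ suc k) ∎
  where
  open ≡-Reasoning
  U = mixedCount B c k h
  U' = mixedCount B c k (not h)
  s = bit (not (h xor odd k))
  s' = bit (not (not h xor odd k))
  P = (+ B ℤ.+ + c) ℤ.^ k
  Q = (+ B ℤ.- + c) ℤ.^ k
  C = (+ c) ℤ.^ k

  flipped-closedForm : + 2 ℤ.* + B ℤ.* + U' ≡ P ℤ.+ ℤ.- sign h ℤ.* Q ℤ.- + s' ℤ.* (+ 2 ℤ.* C)
  flipped-closedForm = trans (mixedCount-closedForm B c k (not h))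
                             (cong (λ σ → P ℤ.+ σ ℤ.* Q ℤ.- + s' ℤ.* (+ 2 ℤ.* C)) (sign-not h))

  expand : ∀ B c U U' s C →
    + 2 ℤ.* B ℤ.* (B ℤ.* U ℤ.+ c ℤ.* U' ℤ.+ s ℤ.* C)
      ≡ B ℤ.* (+ 2 ℤ.* B ℤ.* U) ℤ.+ c ℤ.* (+ 2 ℤ.* B ℤ.* U') ℤ.+ + 2 ℤ.* B ℤ.* s ℤ.* C
  expand = ℤ-Solver.solve-∀

  collect : ∀ B c P Q C σ s s' →
    B ℤ.* (P ℤ.+ σ ℤ.* Q ℤ.- s ℤ.* (+ 2 ℤ.* C)) ℤ.+ c ℤ.* (P ℤ.+ ℤ.- σ ℤ.* Q ℤ.- s' ℤ.* (+ 2 ℤ.* C))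
      ℤ.+ + 2 ℤ.* B ℤ.* s ℤ.* C
      ≡ (B ℤ.+ c) ℤ.* P ℤ.+ σ ℤ.* ((B ℤ.- c) ℤ.* Q) ℤ.- s' ℤ.* (+ 2 ℤ.* (c ℤ.* C))
  collect = ℤ-Solver.solve-∀

mixedCount-even : ∀ B c k → odd k ≡ false →
  + 2 ℤ.* + B ℤ.* + mixedCount B c k false ≡ (+ B ℤ.+ + c) ℤ.^ k ℤ.+ (+ B ℤ.- + c) ℤ.^ k ℤ.- + 2 ℤ.* (+ c) ℤ.^ k
mixedCount-even B c k odd-k = begin
  + 2 ℤ.* + B ℤ.* + mixedCount B c k false
    ≡⟨ mixedCount-closedForm B c k false ⟩
  P ℤ.+ ℤ.1ℤ ℤ.* Q ℤ.- + bit (not (odd k)) ℤ.* (+ 2 ℤ.* C)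
    ≡⟨ cong (λ o → P ℤ.+ ℤ.1ℤ ℤ.* Q ℤ.- + bit (not o) ℤ.* (+ 2 ℤ.* C)) odd-k ⟩
  P ℤ.+ ℤ.1ℤ ℤ.* Q ℤ.- ℤ.1ℤ ℤ.* (+ 2 ℤ.* C)
    ≡⟨ cong₂ (λ x y → P ℤ.+ x ℤ.- y) (ℤ.*-identityˡ Q) (ℤ.*-identityˡ (+ 2 ℤ.* C)) ⟩
  P ℤ.+ Q ℤ.- + 2 ℤ.* C ∎
  where
  open ≡-Reasoning
  P = (+ B ℤ.+ + c) ℤ.^ k
  Q = (+ B ℤ.- + c) ℤ.^ k
  C = (+ c) ℤ.^ k

m+n≡o+p⇒m-p≡o-n : ∀ m n o p → m + n ≡ o + p → + m ℤ.- + p ≡ + o ℤ.- + n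
m+n≡o+p⇒m-p≡o-n m n o p m+n≡o+p = begin
  + m ℤ.- + p                    ≡⟨ add-sub (+ m) (+ n) (+ p) ⟩
  + m ℤ.+ + n ℤ.- + n ℤ.- + p    ≡⟨ cong (λ x → + x ℤ.- + n ℤ.- + p) m+n≡o+p ⟩
  + o ℤ.+ + p ℤ.- + n ℤ.- + p    ≡⟨ add-sub' (+ o) (+ p) (+ n) ⟩
  + o ℤ.- + n                    ∎
  where
  open ≡-Reasoning
  add-sub : ∀ x y z → x ℤ.- z ≡ x ℤ.+ y ℤ.- y ℤ.- z
  add-sub = ℤ-Solver.solve-∀
  add-sub' : ∀ x y z → x ℤ.+ y ℤ.- z ℤ.- y ≡ x ℤ.- z
  add-sub' = ℤ-Solver.solve-∀

numerator : ℕ → ℤ → ℤ → ℤ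
numerator k B C = (B ℤ.+ C) ℤ.^ k ℤ.+ (B ℤ.- C) ℤ.^ k ℤ.- (B ℤ.+ C ℤ.- + 1) ℤ.^ k ℤ.- (B ℤ.- C ℤ.+ + 1) ℤ.^ k
                  ℤ.- + 2 ℤ.* C ℤ.^ k ℤ.+ + 2 ℤ.* (C ℤ.- + 1) ℤ.^ k

d-closedForm : ∀ k b c → odd (suc k) ≡ false → c < 2 ^ b →
  + (2 ^ (b + 1)) ℤ.* (+ d (suc k) (2 ^ b + c) ℤ.- + d (suc k) c) ≡ numerator (suc k) (+ (2 ^ b)) (+ suc c)
d-closedForm k b c odd-k c<B = begin
  + (2 ^ (b + 1)) ℤ.* (+ d K (2 ^ b + c) ℤ.- + d K c)
    ≡⟨ cong₂ ℤ._*_ 2^[b+1] (m+n≡o+p⇒m-p≡o-n (d K (2 ^ b + c)) U U⁺ (d K c) (d-recurrence k b c odd-k c<B)) ⟩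
  + 2 ℤ.* B ℤ.* (+ U⁺ ℤ.- + U)
    ≡⟨ distrib (+ 2 ℤ.* B) (+ U⁺) (+ U) ⟩
  + 2 ℤ.* B ℤ.* + U⁺ ℤ.- + 2 ℤ.* B ℤ.* + U
    ≡⟨ cong₂ ℤ._-_ (mixedCount-even (2 ^ b) (suc c) K odd-k) (mixedCount-even (2 ^ b) c K odd-k) ⟩
  (B ℤ.+ C) ℤ.^ K ℤ.+ (B ℤ.- C) ℤ.^ K ℤ.- + 2 ℤ.* C ℤ.^ K
    ℤ.- ((B ℤ.+ + c) ℤ.^ K ℤ.+ (B ℤ.- + c) ℤ.^ K ℤ.- + 2 ℤ.* (+ c) ℤ.^ K)
    ≡⟨ cong₂ (λ x y → (B ℤ.+ C) ℤ.^ K ℤ.+ (B ℤ.- C) ℤ.^ K ℤ.- + 2 ℤ.* C ℤ.^ K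
                        ℤ.- (x ℤ.^ K ℤ.+ y ℤ.^ K ℤ.- + 2 ℤ.* (+ c) ℤ.^ K))
             (shift-down B (+ c)) (shift-up B (+ c)) ⟩
  (B ℤ.+ C) ℤ.^ K ℤ.+ (B ℤ.- C) ℤ.^ K ℤ.- + 2 ℤ.* C ℤ.^ K
    ℤ.- ((B ℤ.+ C ℤ.- + 1) ℤ.^ K ℤ.+ (B ℤ.- C ℤ.+ + 1) ℤ.^ K ℤ.- + 2 ℤ.* (C ℤ.- + 1) ℤ.^ K)
    ≡⟨ regroup ((B ℤ.+ C) ℤ.^ K) ((B ℤ.- C) ℤ.^ K) (C ℤ.^ K)
               ((B ℤ.+ C ℤ.- + 1) ℤ.^ K) ((B ℤ.- C ℤ.+ + 1) ℤ.^ K) ((C ℤ.- + 1) ℤ.^ K) ⟩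
  numerator K B C ∎
  where
  open ≡-Reasoning
  K = suc k
  B = + (2 ^ b)
  C = + suc c
  U = mixedCount (2 ^ b) c K false
  U⁺ = mixedCount (2 ^ b) (suc c) K false

  2^[b+1] : + (2 ^ (b + 1)) ≡ + 2 ℤ.* B
  2^[b+1] = trans (cong (λ e → + (2 ^ e)) (+-comm b 1)) (ℤ.pos-* 2 (2 ^ b))
  distrib : ∀ a u v → a ℤ.* (u ℤ.- v) ≡ a ℤ.* u ℤ.- a ℤ.* v
  distrib = ℤ-Solver.solve-∀
  shift-down : ∀ B x → B ℤ.+ x ≡ B ℤ.+ (+ 1 ℤ.+ x) ℤ.- + 1
  shift-down = ℤ-Solver.solve-∀
  shift-up : ∀ B x → B ℤ.- x ≡ B ℤ.- (+ 1 ℤ.+ x) ℤ.+ + 1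
  shift-up = ℤ-Solver.solve-∀
  regroup : ∀ X⁺ Y⁺ Z⁺ X Y Z →
    X⁺ ℤ.+ Y⁺ ℤ.- + 2 ℤ.* Z⁺ ℤ.- (X ℤ.+ Y ℤ.- + 2 ℤ.* Z) ≡ X⁺ ℤ.+ Y⁺ ℤ.- X ℤ.- Y ℤ.- + 2 ℤ.* Z⁺ ℤ.+ + 2 ℤ.* Z
  regroup = ℤ-Solver.solve-∀

theorem18 : (k : ℕ) → 0 < k → 2 ∣ k → (n : ℕ) → 0 < n →
    let b = ⌊log₂ n ⌋
        c = (n + 1) ∸ (2 ^ b)
        B = + (2 ^ b)
        C = + c
    in + (2 ^ (b + 1)) ℤ.* (+ d k n ℤ.- + d k (c ∸ 1))
       ≡ (B ℤ.+ C) ℤ.^ k ℤ.+ (B ℤ.- C) ℤ.^ k ℤ.- (B ℤ.+ C ℤ.- + 1) ℤ.^ k ℤ.- (B ℤ.- C ℤ.+ + 1) ℤ.^ k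
         ℤ.- + 2 ℤ.* C ℤ.^ k ℤ.+ + 2 ℤ.* (C ℤ.- + 1) ℤ.^ k
theorem18 (suc k) _ 2∣k n 0<n = begin
  + (2 ^ (b + 1)) ℤ.* (+ d (suc k) n ℤ.- + d (suc k) (c ∸ 1))
    ≡⟨ cong₂ (λ m m' → + (2 ^ (b + 1)) ℤ.* (+ d (suc k) m ℤ.- + d (suc k) (m' ∸ 1))) n≡B+c' c≡1+c' ⟩
  + (2 ^ (b + 1)) ℤ.* (+ d (suc k) (2 ^ b + c') ℤ.- + d (suc k) c')
    ≡⟨ d-closedForm k b c' (2∣⇒odd≡false 2∣k) c'<B ⟩
  numerator (suc k) (+ (2 ^ b)) (+ suc c')
    ≡⟨ cong (numerator (suc k) (+ (2 ^ b)) ∘ +_) c≡1+c' ⟨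
  numerator (suc k) (+ (2 ^ b)) (+ c) ∎
  where
  open ≡-Reasoning
  b = ⌊log₂ n ⌋
  c = (n + 1) ∸ 2 ^ b
  c' = n ∸ 2 ^ b
  B≤n : 2 ^ b ≤ n
  B≤n = 2^⌊log₂n⌋≤n 0<n
  n≡B+c' : n ≡ 2 ^ b + c'
  n≡B+c' = sym (m+[n∸m]≡n B≤n)
  c≡1+c' : c ≡ suc c'
  c≡1+c' = trans (+-∸-comm 1 B≤n) (+-comm c' 1)
  c'<B : c' < 2 ^ b
  c'<B = subst (c' <_) (+-identityʳ (2 ^ b))
    (+-cancelˡ-< (2 ^ b) c' (2 ^ b + 0) (subst (_< 2 ^ suc b) n≡B+c' (n<2^[1+⌊log₂n⌋] n)))
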